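{- Let $n\ge 10$ be even, let $s>0$ be an integer and $1\le i<j\le n$. Let $G_{n-2}$ be the complement of the disjoint union of two cycles each of length $(n-2)/2$. Then $\{s,2s,\dots,ns\}\setminus\{is,js\}$ is not a signature for $G_{n-2}$.
   Context: A finite simple graph $G=(V,E)$ has signature $S$ (a finite set of integers) if there is a bijection $\pi:S\to V$ such that for any two distinct $a,b\in S$, $\pi(a)$ and $\pi(b)$ are adjacent iff $|a-b|\in S$. -}

module Defs where

open import Data.Nat using (ℕ; zero; suc; _+_; _*_; _∸_; _≤_; _<_; _%_; _/_)
open import Data.Fin using (Fin; toℕ)
open import Data.Integer using (ℤ; +_; _-_; ∣_∣)
open import Data.Product using (Σ; _×_; _,_; proj₁; ∃-syntax)
open import Data.Sum using (_⊎_)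
open import Relation.Nullary using (¬_)
open import Relation.Binary.PropositionalEquality using (_≡_; _≢_)
open import Function.Bundles using (_⇔_)

-- Elements of S are pairs (a , proof a ∈ S); injectivity is stated on the
-- underlying integers.
HasSignature : (V : Set) → (Adj : V → V → Set) → (S : ℤ → Set) → Set
HasSignature V Adj S =
  Σ (Σ ℤ S → V) λ π →
    (∀ a b → π a ≡ π b → proj₁ a ≡ proj₁ b) ×
    (∀ v → ∃[ a ] π a ≡ v) ×
    (∀ a b → proj₁ a ≢ proj₁ b →
       (Adj (π a) (π b) ⇔ S (+ ∣ proj₁ a - proj₁ b ∣)))

CycSucc : (k : ℕ) → Fin k → Fin k → Set
CycSucc k x y = (toℕ y ≡ suc (toℕ x)) ⊎ ((suc (toℕ x) ≡ k) × (toℕ y ≡ 0))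

CycleAdj : (k : ℕ) → Fin k → Fin k → Set
CycleAdj k x y = CycSucc k x y ⊎ CycSucc k y x

TwoCyclesAdj : (k : ℕ) → Fin 2 × Fin k → Fin 2 × Fin k → Set
TwoCyclesAdj k (c , x) (d , y) = (c ≡ d) × CycleAdj k x y

GVertex : ℕ → Set
GVertex n = Fin 2 × Fin ((n ∸ 2) / 2)

GAdj : (n : ℕ) → GVertex n → GVertex n → Set
GAdj n u v = (u ≢ v) × ¬ TwoCyclesAdj ((n ∸ 2) / 2) u v

SigSet : (n s i j : ℕ) → ℤ → Set
SigSet n s i j a =
  ∃[ k ] (1 ≤ k × k ≤ n × k ≢ i × k ≢ j × a ≡ + (k * s))

module Submission where

-- Write n = 2m + 2, so G has the 2m vertices Fin 2 × Fin m, and the proposed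
-- signature consists of the multiples k·s of the n − 2 = 2m indices
-- k ∈ {1, …, n} \ {i, j}.  Two vertices with indices k ≠ l are adjacent in G
-- iff |k − l| is again an index, i.e. iff |k − l| ∉ {i, j}.  Hence a signature
-- makes the "distance graph" on the indices, in which k and l are joined when
-- |k − l| ∈ {i, j}, a copy of the two cycles: 2-regular and triangle-free.

open import Defs
open import Data.Nat using (ℕ; _≤_; _<_)
open import Data.Nat.Divisibility using (_∣_; divides)
open import Relation.Nullary using (¬_)
open import Data.Nat as ℕ
  using (zero; suc; _+_; _*_; _∸_; _/_; z≤n; s≤s; ∣_-_∣; _≟_; _≤?_; _<?_; >-nonZero)
open import Data.Nat.Properties
  using ( ≤-refl; ≤-reflexive; ≤-trans; ≤-antisym; ≤-total; <-irrefl; <-trans; <-cmp; <⇒≤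
        ; <⇒≢; >⇒≢; <⇒≱; ≰⇒>; ≮⇒≥; n<1+n; m<m+n; m≤m+n; m≤n+m; 1+n≢n; suc-injective
        ; +-comm; +-suc; +-cancelʳ-≡; +-mono-≤; +-monoʳ-≤; *-cancelʳ-≡; m≤n⇒∃[o]m+o≡n; n≢0⇒n>0
        ; ∣-∣-comm; ∣m-m+n∣≡n; ∣m-n∣≡0⇒m≡n; m≡n⇒∣m-n∣≡0; ∣m-n∣≤m⊔n; ⊔-lub; *-distribʳ-∣-∣
        ; m≤n⇒∣m-n∣≡n∸m; m≤n⇒∣n-m∣≡n∸m)
open import Data.Nat.DivMod using (m*n/n≡m)
open import Data.Nat.Tactic.RingSolver using (solve)
open import Data.Integer as ℤ using (ℤ; +_; _⊖_)
open import Data.Integer.Properties using (+-injective; ∣⊖∣-≤; ∣m⊖n∣≡∣n⊖m∣; [+m]-[+n]≡m⊖n)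
open import Data.Fin using (Fin; toℕ; fromℕ<; fromℕ; inject₁; punchOut; join; splitAt; combine; remQuot)
  renaming (zero to 0F; suc to sucF)
open import Data.Fin.Properties
  using (toℕ-injective; toℕ<n; toℕ-fromℕ<; toℕ-fromℕ; toℕ-inject₁; any?; pigeonhole
        ; punchOut-injective; splitAt-join; remQuot-combine)
  renaming (_≟_ to _≟F_)
open import Data.List using (_∷_; [])
open import Data.Product using (Σ; _×_; _,_; proj₁; proj₂; ∃; ∃₂)
open import Data.Sum using (_⊎_; inj₁; inj₂; [_,_]′)
open import Data.Sum.Properties using (inj₁-injective)
open import Data.Empty using (⊥; ⊥-elim)
open import Relation.Nullary using (Dec; yes; no)
open import Relation.Nullary.Decidable using (_×-dec_; _⊎-dec_; ¬?; recompute; decidable-stable)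
open import Relation.Binary.PropositionalEquality
  using (_≡_; _≢_; refl; sym; trans; cong; subst; module ≡-Reasoning)
open import Relation.Binary.Definitions using (tri<; tri≈; tri>)
open import Function.Bundles using (_⇔_; Equivalence; mk⇔)

-- k is an index: 1 ≤ k ≤ n and k ∉ {i, j}; these are the k with k·s ∈ S.
Index : ℕ → ℕ → ℕ → ℕ → Set
Index n i j k = 1 ≤ k × k ≤ n × k ≢ i × k ≢ j

Near : ℕ → ℕ → ℕ → ℕ → Set
Near i j k l = ∣ k - l ∣ ≡ i ⊎ ∣ k - l ∣ ≡ j

≤-by : ∀ {a b} w → a + w ≡ b → a ≤ b
≤-by {a} w refl = m≤m+n a w

below : ∀ {k l x} → k < x → k ≢ l + x
below {k} {l} {x} k<x e = <⇒≱ k<x (subst (x ≤_) (sym e) (m≤n+m x l))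

above : ∀ {l n x} → l ≤ n → n < x → l ≢ x
above l≤n n<x refl = <⇒≱ n<x l≤n

same-difference : ∀ {k l y x} → k ≡ l + x → k ≡ y + x → l ≡ y
same-difference {x = x} e₁ e₂ = +-cancelʳ-≡ x _ _ (trans (sym e₁) e₂)

distance-up : ∀ a b d → b ≡ a + d → ∣ a - b ∣ ≡ d
distance-up a _ d refl = ∣m-m+n∣≡n a d

distance-down : ∀ a b d → a ≡ b + d → ∣ a - b ∣ ≡ d
distance-down a b d e = trans (∣-∣-comm a b) (distance-up b a d e)

distance-cases : ∀ k l {d} → ∣ k - l ∣ ≡ d → l ≡ k + d ⊎ k ≡ l + d
distance-cases zero    l       e = inj₁ e
distance-cases (suc k) zero    e = inj₂ e
distance-cases (suc k) (suc l) e with distance-cases k l e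
... | inj₁ e′ = inj₁ (cong suc e′)
... | inj₂ e′ = inj₂ (cong suc e′)

∣⊖∣≡∣-∣ : ∀ a b → ℤ.∣ a ⊖ b ∣ ≡ ∣ a - b ∣
∣⊖∣≡∣-∣ a b with ≤-total a b
... | inj₁ a≤b = trans (∣⊖∣-≤ a≤b) (sym (m≤n⇒∣m-n∣≡n∸m a≤b))
... | inj₂ b≤a = trans (∣m⊖n∣≡∣n⊖m∣ a b) (trans (∣⊖∣-≤ b≤a) (sym (m≤n⇒∣n-m∣≡n∸m b≤a)))

distance-positive : ∀ {k l} → k ≢ l → 1 ≤ ∣ k - l ∣
distance-positive k≢l = n≢0⇒n>0 (λ e → k≢l (∣m-n∣≡0⇒m≡n e))

distance-bounded : ∀ {k l n} → k ≤ n → l ≤ n → ∣ k - l ∣ ≤ n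
distance-bounded {k} {l} k≤n l≤n = ≤-trans (∣m-n∣≤m⊔n k l) (⊔-lub k≤n l≤n)

record Lonely (n i j : ℕ) : Set where
  constructor lonely
  field
    centre partner : ℕ
    centre-index : Index n i j centre
    only-partner : ∀ l → Index n i j l → Near i j centre l → l ≡ partner

record Claw (n i j : ℕ) : Set where
  constructor claw
  field
    centre a b c : ℕ
    centre-index : Index n i j centre
    a-index : Index n i j a
    b-index : Index n i j b
    c-index : Index n i j c
    a≢b : a ≢ b
    a≢c : a ≢ c
    b≢c : b ≢ c
    near-a : Near i j centre a
    near-b : Near i j centre b
    near-c : Near i j centre c

record Triangle (n i j : ℕ) : Set where
  constructor triangle
  field
    a b c : ℕ
    a-index : Index n i j a
    b-index : Index n i j b
    c-index : Index n i j c
    a≢b : a ≢ b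
    a≢c : a ≢ c
    b≢c : b ≢ c
    near-ab : Near i j a b
    near-ac : Near i j a c
    near-bc : Near i j b c

-- The distance graph of the two cycles has none of these configurations.
Obstruction : ℕ → ℕ → ℕ → Set
Obstruction n i j = Lonely n i j ⊎ Claw n i j ⊎ Triangle n i j

lonely-by-cases : ∀ {n i j} k c → Index n i j k →
  (∀ l → Index n i j l → l ≡ k + i → l ≡ c) →
  (∀ l → Index n i j l → k ≡ l + i → l ≡ c) →
  (∀ l → Index n i j l → l ≡ k + j → l ≡ c) →
  (∀ l → Index n i j l → k ≡ l + j → l ≡ c) → Obstruction n i j
lonely-by-cases {n} {i} {j} k c k∈ up-i down-i up-j down-j = inj₁ (lonely k c k∈ only)
  where
  only : ∀ l → Index n i j l → Near i j k l → l ≡ c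
  only l l∈ (inj₁ e) = [ up-i l l∈ , down-i l l∈ ]′ (distance-cases k l e)
  only l l∈ (inj₂ e) = [ up-j l l∈ , down-j l l∈ ]′ (distance-cases k l e)

small-index : ∀ {n i j} k w → suc k + w ≡ 10 → 10 ≤ n →
              suc k ≢ i → suc k ≢ j → Index n i j (suc k)
small-index k w e 10≤n k≢i k≢j = s≤s z≤n , ≤-trans (≤-by w e) 10≤n , k≢i , k≢j

-- For j ≥ 5 compare n with j + 2: a claw at 3 (neighbours 2, 4, j + 3), or
-- the lonely index j + 1 (when n = j + 2), or the lonely index 2.
obstruction-1-large : ∀ n j → 10 ≤ n → 5 ≤ j → j ≤ n → Obstruction n 1 j
obstruction-1-large n j 10≤n 5≤j j≤n with <-cmp (j + 2) n
... | tri< j+2<n _ _ =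
  inj₂ (inj₁ (claw 3 2 4 (3 + j)
    (small-index 2 7 refl 10≤n (λ ()) (<⇒≢ (≤-trans (≤-by 1 refl) 5≤j)))
    (small-index 1 8 refl 10≤n (λ ()) (<⇒≢ (≤-trans (≤-by 2 refl) 5≤j)))
    (small-index 3 6 refl 10≤n (λ ()) (<⇒≢ 5≤j))
    (s≤s z≤n , subst (_≤ n) (cong suc (+-comm j 2)) j+2<n , (λ ()) , λ e → <-irrefl (sym e) (m≤n+m (suc j) 2))
    (λ ()) (λ ()) (<⇒≢ (s≤s (s≤s (s≤s (≤-trans (≤-by 3 refl) 5≤j)))))
    (inj₁ refl) (inj₁ refl) (inj₂ refl)))
... | tri≈ _ refl _ =
  lonely-by-cases (suc j) (suc j + 1) (s≤s z≤n , ≤-by 1 (sym (+-suc j 1)) , 1+j≢1 , λ e → <-irrefl (sym e) ≤-refl)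
    (λ _ _ e → e)
    (λ _ (_ , _ , _ , l≢j) e → ⊥-elim (l≢j (same-difference e (+-comm 1 j))))
    (λ _ (_ , l≤n , _ , _) e → ⊥-elim (above l≤n (+-monoʳ-≤ (suc j) (≤-trans (≤-by 3 refl) 5≤j)) e))
    (λ _ (_ , _ , l≢1 , _) e → ⊥-elim (l≢1 (same-difference e refl)))
  where
  1+j≢1 : suc j ≢ 1
  1+j≢1 e = <⇒≢ (≤-trans (≤-by 4 refl) 5≤j) (sym (suc-injective e))
... | tri> _ _ n<j+2 =
  lonely-by-cases 2 3 (s≤s z≤n , ≤-trans (≤-by 8 refl) 10≤n , (λ ()) , 2≢j)
    (λ _ _ e → e)
    (λ _ (_ , _ , l≢1 , _) e → ⊥-elim (l≢1 (same-difference e refl)))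
    (λ _ (_ , l≤n , _ , _) e → ⊥-elim (above l≤n (subst (n <_) (+-comm j 2) n<j+2) e))
    (λ _ _ e → ⊥-elim (below (≤-trans (≤-by 2 refl) 5≤j) e))
  where
  2≢j : 2 ≢ j
  2≢j = <⇒≢ (≤-trans (≤-by 2 refl) 5≤j)

-- i = 1: j = 2 gives the claw 4 ~ 3, 5, 6; j = 3 the lonely index 2, whose
-- only neighbour is 5; j = 4 the claw 6 ~ 5, 7, 2; larger j is handled above.
obstruction-1 : ∀ n j → 10 ≤ n → 1 < j → j ≤ n → Obstruction n 1 j
obstruction-1 n 0 _ () _
obstruction-1 n 1 _ (s≤s ()) _
obstruction-1 n 2 10≤n _ _ =
  inj₂ (inj₁ (claw 4 3 5 6
    (small-index 3 6 refl 10≤n (λ ()) (λ ())) (small-index 2 7 refl 10≤n (λ ()) (λ ()))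
    (small-index 4 5 refl 10≤n (λ ()) (λ ())) (small-index 5 4 refl 10≤n (λ ()) (λ ()))
    (λ ()) (λ ()) (λ ()) (inj₁ refl) (inj₁ refl) (inj₂ refl)))
obstruction-1 n 3 10≤n _ _ =
  lonely-by-cases 2 5 (small-index 1 8 refl 10≤n (λ ()) (λ ()))
    (λ _ (_ , _ , _ , l≢3) e → ⊥-elim (l≢3 e))
    (λ _ (_ , _ , l≢1 , _) e → ⊥-elim (l≢1 (same-difference e refl)))
    (λ _ _ e → e)
    (λ _ _ e → ⊥-elim (below ≤-refl e))
obstruction-1 n 4 10≤n _ _ =
  inj₂ (inj₁ (claw 6 5 7 2
    (small-index 5 4 refl 10≤n (λ ()) (λ ())) (small-index 4 5 refl 10≤n (λ ()) (λ ()))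
    (small-index 6 3 refl 10≤n (λ ()) (λ ())) (small-index 1 8 refl 10≤n (λ ()) (λ ()))
    (λ ()) (λ ()) (λ ()) (inj₁ refl) (inj₁ refl) (inj₂ refl)))
obstruction-1 n j@(suc (suc (suc (suc (suc _))))) 10≤n _ j≤n =
  obstruction-1-large n j 10≤n (s≤s (s≤s (s≤s (s≤s (s≤s z≤n))))) j≤n

-- The case i ≥ 2, written i = 2 + p, j = i + 1 + q and n = j + r.
Obs : ℕ → ℕ → ℕ → Set
Obs p q r = Obstruction (3 + p + q + r) (2 + p) (3 + p + q)

-- j − i ≤ i − 1: the index j − i has no neighbour below it, and its upper
-- neighbour at distance i is j itself; so its only neighbour is 2j − i.
obstruction-close : ∀ p q r → q ≤ p → Obs p q r
obstruction-close p q r q≤p =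
  lonely-by-cases (suc q) (suc q + (3 + p + q)) k∈
    (λ _ (_ , _ , _ , l≢j) e → ⊥-elim (l≢j (trans e k+i≡j)))
    (λ _ _ e → ⊥-elim (below k<i e))
    (λ _ _ e → e)
    (λ _ _ e → ⊥-elim (below k<j e))
  where
  k<i : suc q < 2 + p
  k<i = s≤s (s≤s q≤p)
  k+i≡j : suc q + (2 + p) ≡ 3 + p + q
  k+i≡j = solve (p ∷ q ∷ [])
  k<j : suc q < 3 + p + q
  k<j = ≤-by (suc p) (solve (p ∷ q ∷ []))
  k∈ : Index (3 + p + q + r) (2 + p) (3 + p + q) (suc q)
  k∈ = s≤s z≤n , ≤-by (2 + p + r) (solve (p ∷ q ∷ r ∷ [])) , <⇒≢ k<i , <⇒≢ k<j

-- i ≤ j − i and n − j ≤ i − 2: the index i − 1 has the single neighbour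
-- 2i − 1, since i − 1 + j already exceeds n.  (Here p = r + w, q = p + 1 + t.)
obstruction-short-tail : ∀ r w t → Obs (r + w) (suc (r + w) + t) r
obstruction-short-tail r w t =
  lonely-by-cases (suc (r + w)) (suc (r + w) + (2 + (r + w))) k∈
    (λ _ _ e → e)
    (λ _ _ e → ⊥-elim (below (n<1+n (suc (r + w))) e))
    (λ _ (_ , l≤n , _ , _) e → ⊥-elim (above l≤n n<k+j e))
    (λ _ _ e → ⊥-elim (below k<j e))
  where
  k<j : suc (r + w) < 3 + (r + w) + (suc (r + w) + t)
  k<j = ≤-by (2 + r + w + t) (solve (r ∷ w ∷ t ∷ []))
  n<k+j : 3 + (r + w) + (suc (r + w) + t) + r < suc (r + w) + (3 + (r + w) + (suc (r + w) + t))
  n<k+j = ≤-by w (solve (r ∷ w ∷ t ∷ []))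
  k∈ : Index (3 + (r + w) + (suc (r + w) + t) + r) (2 + (r + w)) (3 + (r + w) + (suc (r + w) + t)) (suc (r + w))
  k∈ = s≤s z≤n , ≤-by (3 + r + w + t + r) (solve (r ∷ w ∷ t ∷ [])) , <⇒≢ (n<1+n (suc (r + w))) , <⇒≢ k<j

-- j = 2i and n = 3i − 1: the triangle 1, i + 1, j + 1, with differences i, j, i.
obstruction-triangle : ∀ p → Obs p (suc p + 0) (suc p + 0)
obstruction-triangle p =
  inj₂ (inj₂ (triangle 1 (3 + p) (4 + p + (suc p + 0))
    (s≤s z≤n , s≤s z≤n , (λ ()) , (λ ())) b∈ c∈
    (λ ()) (λ ()) (<⇒≢ (<-trans b<j (n<1+n _)))
    (inj₁ refl) (inj₂ refl) (inj₁ (distance-up (2 + p) (3 + p + (suc p + 0)) (2 + p) (solve (p ∷ []))))))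
  where
  b<j : 3 + p < 3 + p + (suc p + 0)
  b<j = ≤-by p (solve (p ∷ []))
  b∈ : Index (3 + p + (suc p + 0) + (suc p + 0)) (2 + p) (3 + p + (suc p + 0)) (3 + p)
  b∈ = s≤s z≤n , ≤-by (2 + p + p) (solve (p ∷ [])) , 1+n≢n , <⇒≢ b<j
  i<c : 2 + p < 4 + p + (suc p + 0)
  i<c = ≤-by (2 + p) (solve (p ∷ []))
  c∈ : Index (3 + p + (suc p + 0) + (suc p + 0)) (2 + p) (3 + p + (suc p + 0)) (4 + p + (suc p + 0))
  c∈ = s≤s z≤n , ≤-by p (solve (p ∷ [])) , >⇒≢ i<c , 1+n≢n

-- j − i > i and n = j + i − 1: the index j − i has the single neighbour
-- j − 2i, its other candidates being j itself or lying outside 1 … n.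
obstruction-far-tail : ∀ p t → Obs p (suc p + suc t) (suc p + 0)
obstruction-far-tail p t =
  lonely-by-cases (suc (suc p + suc t)) (suc t) k∈
    (λ _ (_ , _ , _ , l≢j) e → ⊥-elim (l≢j (trans e (solve (p ∷ t ∷ [])))))
    (λ _ _ e → same-difference e (solve (p ∷ t ∷ [])))
    (λ _ (_ , l≤n , _ , _) e → ⊥-elim (above l≤n n<k+j e))
    (λ _ _ e → ⊥-elim (below k<j e))
  where
  k<j : suc (suc p + suc t) < 3 + p + (suc p + suc t)
  k<j = ≤-by (suc p) (solve (p ∷ t ∷ []))
  n<k+j : 3 + p + (suc p + suc t) + (suc p + 0) < suc (suc p + suc t) + (3 + p + (suc p + suc t))
  n<k+j = ≤-by (suc t) (solve (p ∷ t ∷ []))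
  i<k : 2 + p < suc (suc p + suc t)
  i<k = ≤-by t (solve (p ∷ t ∷ []))
  k∈ : Index (3 + p + (suc p + suc t) + (suc p + 0)) (2 + p) (3 + p + (suc p + suc t)) (suc (suc p + suc t))
  k∈ = s≤s z≤n , ≤-by (3 + p + p) (solve (p ∷ t ∷ [])) , >⇒≢ i<k , <⇒≢ k<j

-- n = i + j: the index n is isolated, as n − i = j and n − j = i are excluded.
obstruction-sum : ∀ p t → Obs p (suc p + t) (suc p + 1)
obstruction-sum p t =
  lonely-by-cases n 0 (s≤s z≤n , ≤-refl , >⇒≢ i<n , >⇒≢ j<n)
    (λ _ (_ , l≤n , _ , _) e → ⊥-elim (above l≤n (m<m+n n (s≤s z≤n)) e))
    (λ _ (_ , _ , _ , l≢j) e → ⊥-elim (l≢j (same-difference e n≡j+i)))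
    (λ _ (_ , l≤n , _ , _) e → ⊥-elim (above l≤n (m<m+n n (s≤s z≤n)) e))
    (λ _ (_ , _ , l≢i , _) e → ⊥-elim (l≢i (same-difference e n≡i+j)))
  where
  n : ℕ
  n = 3 + p + (suc p + t) + (suc p + 1)
  n≡j+i : 3 + p + (suc p + t) + (suc p + 1) ≡ 3 + p + (suc p + t) + (2 + p)
  n≡j+i = solve (p ∷ t ∷ [])
  n≡i+j : 3 + p + (suc p + t) + (suc p + 1) ≡ 2 + p + (3 + p + (suc p + t))
  n≡i+j = solve (p ∷ t ∷ [])
  i<n : 2 + p < 3 + p + (suc p + t) + (suc p + 1)
  i<n = ≤-by (3 + p + t + p) (solve (p ∷ t ∷ []))
  j<n : 3 + p + (suc p + t) < 3 + p + (suc p + t) + (suc p + 1)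
  j<n = m<m+n _ (s≤s z≤n)

-- n > i + j: the claw j + 1 ~ 1, j + 1 − i, j + 1 + i.
obstruction-claw : ∀ p t u → Obs p (suc p + t) (suc p + suc (suc u))
obstruction-claw p t u =
  inj₂ (inj₁ (claw (4 + p + (suc p + t)) 1 (3 + p + t) (4 + p + (suc p + t) + (2 + p))
    k∈ (s≤s z≤n , s≤s z≤n , (λ ()) , (λ ())) b∈ c∈
    (λ ()) (λ ()) (<⇒≢ (<-trans b<j (<-trans (n<1+n _) k<c)))
    (inj₂ refl)
    (inj₁ (distance-down (4 + p + (suc p + t)) (3 + p + t) (2 + p) (solve (p ∷ t ∷ []))))
    (inj₁ (distance-up (4 + p + (suc p + t)) (4 + p + (suc p + t) + (2 + p)) (2 + p) refl))))
  where
  i<k : 2 + p < 4 + p + (suc p + t)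
  i<k = ≤-by (2 + p + t) (solve (p ∷ t ∷ []))
  k∈ : Index (3 + p + (suc p + t) + (suc p + suc (suc u))) (2 + p) (3 + p + (suc p + t)) (4 + p + (suc p + t))
  k∈ = s≤s z≤n , ≤-by (2 + p + u) (solve (p ∷ t ∷ u ∷ [])) , >⇒≢ i<k , 1+n≢n
  i<b : 2 + p < 3 + p + t
  i<b = ≤-by t (solve (p ∷ t ∷ []))
  b<j : 3 + p + t < 3 + p + (suc p + t)
  b<j = ≤-by p (solve (p ∷ t ∷ []))
  b∈ : Index (3 + p + (suc p + t) + (suc p + suc (suc u))) (2 + p) (3 + p + (suc p + t)) (3 + p + t)
  b∈ = s≤s z≤n , ≤-by (4 + p + p + u) (solve (p ∷ t ∷ u ∷ [])) , >⇒≢ i<b , <⇒≢ b<j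
  k<c : 4 + p + (suc p + t) < 4 + p + (suc p + t) + (2 + p)
  k<c = m<m+n _ (s≤s z≤n)
  c∈ : Index (3 + p + (suc p + t) + (suc p + suc (suc u))) (2 + p) (3 + p + (suc p + t)) (4 + p + (suc p + t) + (2 + p))
  c∈ = s≤s z≤n , ≤-by u (solve (p ∷ t ∷ u ∷ [])) , >⇒≢ (<-trans i<k k<c) , >⇒≢ (<-trans (n<1+n _) k<c)

-- The case i ≥ 2, split according to j − i versus i and n − j versus i.
obstruction-2 : ∀ p q r → Obs p q r
obstruction-2 p q r with q ≤? p
... | yes q≤p = obstruction-close p q r q≤p
... | no q≰p with m≤n⇒∃[o]m+o≡n (≰⇒> q≰p)
... | t , refl with r ≤? p
...   | yes r≤p with m≤n⇒∃[o]m+o≡n r≤p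
...     | w , refl = obstruction-short-tail r w t
obstruction-2 p _ r | no _ | t , refl | no r≰p with m≤n⇒∃[o]m+o≡n (≰⇒> r≰p)
... | zero , refl with t
...   | zero   = obstruction-triangle p
...   | suc t′ = obstruction-far-tail p t′
obstruction-2 p _ _ | no _ | t , refl | no _ | suc zero , refl = obstruction-sum p t
obstruction-2 p _ _ | no _ | t , refl | no _ | suc (suc u) , refl = obstruction-claw p t u

obstruction : ∀ n i j → 10 ≤ n → 1 ≤ i → i < j → j ≤ n → Obstruction n i j
obstruction n 1 j 10≤n _ i<j j≤n = obstruction-1 n j 10≤n i<j j≤n
obstruction n (suc (suc p)) j _ _ i<j j≤n with m≤n⇒∃[o]m+o≡n i<j
... | q , refl with m≤n⇒∃[o]m+o≡n j≤n
... | r , refl = obstruction-2 p q r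

-- b follows a on the cycle 0 → 1 → … → m − 1 → 0; CycSucc m x y is
-- definitionally Succ m (toℕ x) (toℕ y).
Succ : ℕ → ℕ → ℕ → Set
Succ m a b = b ≡ suc a ⊎ (suc a ≡ m × b ≡ 0)

mutual-successors : ∀ {m a b} → Succ m a b → Succ m b a → m ≤ 2
mutual-successors (inj₁ refl)           (inj₁ ())
mutual-successors (inj₁ refl)           (inj₂ (refl , refl)) = ≤-refl
mutual-successors (inj₂ (refl , refl))  (inj₁ refl)          = ≤-refl
mutual-successors (inj₂ (refl , refl))  (inj₂ (_ , refl))    = s≤s z≤n

successor-triangle : ∀ {m a b c} → Succ m a b → Succ m b c → Succ m c a → m ≤ 3
successor-triangle (inj₁ refl) (inj₁ refl) (inj₁ ())
successor-triangle (inj₁ refl) (inj₁ refl) (inj₂ (refl , refl)) = ≤-refl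
successor-triangle (inj₁ refl) (inj₂ (refl , refl)) (inj₁ refl) = ≤-refl
successor-triangle (inj₁ refl) (inj₂ (refl , refl)) (inj₂ (() , _))
successor-triangle (inj₂ (refl , refl)) (inj₁ refl) (inj₁ refl) = ≤-refl
successor-triangle (inj₂ (refl , refl)) (inj₁ refl) (inj₂ (_ , refl)) = s≤s z≤n
successor-triangle (inj₂ (refl , refl)) (inj₂ (refl , refl)) _ = s≤s z≤n

successor : ∀ {m} (x : Fin m) → Σ (Fin m) (CycSucc m x)
successor {suc m} x with suc (toℕ x) ℕ.<? suc m
... | yes lt = fromℕ< lt , inj₁ (toℕ-fromℕ< lt)
... | no ¬lt = 0F , inj₂ (≤-antisym (toℕ<n x) (≮⇒≥ ¬lt) , refl)

predecessor : ∀ {m} (x : Fin m) → Σ (Fin m) (λ y → CycSucc m y x)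
predecessor {suc m} 0F       = fromℕ m , inj₂ (cong suc (toℕ-fromℕ m) , refl)
predecessor {suc m} (sucF x) = inject₁ x , inj₁ (cong suc (sym (toℕ-inject₁ x)))

successor-unique : ∀ {m} {x y z : Fin m} → CycSucc m x y → CycSucc m x z → y ≡ z
successor-unique (inj₁ e₁) (inj₁ e₂) = toℕ-injective (trans e₁ (sym e₂))
successor-unique {y = y} (inj₁ e₁) (inj₂ (e , _)) = ⊥-elim (<-irrefl (trans e₁ e) (toℕ<n y))
successor-unique {z = z} (inj₂ (e , _)) (inj₁ e₂) = ⊥-elim (<-irrefl (trans e₂ e) (toℕ<n z))
successor-unique (inj₂ (_ , e₁)) (inj₂ (_ , e₂)) = toℕ-injective (trans e₁ (sym e₂))

predecessor-unique : ∀ {m} {x y z : Fin m} → CycSucc m y x → CycSucc m z x → y ≡ z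
predecessor-unique (inj₁ e₁) (inj₁ e₂) = toℕ-injective (suc-injective (trans (sym e₁) e₂))
predecessor-unique (inj₁ e₁) (inj₂ (_ , e₂)) with () ← trans (sym e₁) e₂
predecessor-unique (inj₂ (_ , e₁)) (inj₁ e₂) with () ← trans (sym e₂) e₁
predecessor-unique (inj₂ (e₁ , _)) (inj₂ (e₂ , _)) = toℕ-injective (suc-injective (trans e₁ (sym e₂)))

module TwoCycles (m : ℕ) where

  V : Set
  V = Fin 2 × Fin m

  infix 4 _~_
  _~_ : V → V → Set
  _~_ = TwoCyclesAdj m

  adjacent? : ∀ u v → Dec (u ~ v)
  adjacent? (c , x) (d , y) = (c ≟F d) ×-dec (succ? x y ⊎-dec succ? y x)
    where
    succ? : ∀ x y → Dec (CycSucc m x y)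
    succ? x y = (toℕ y ≟ suc (toℕ x)) ⊎-dec ((suc (toℕ x) ≟ m) ×-dec (toℕ y ≟ 0))

  same-cycle : ∀ {c} {x y : Fin m} → x ≡ y → _≡_ {A = V} (c , x) (c , y)
  same-cycle refl = refl

  irreflexive : 3 ≤ m → ∀ v → ¬ v ~ v
  irreflexive 3≤m _ (refl , inj₁ x↦x) = <⇒≱ 3≤m (mutual-successors x↦x x↦x)
  irreflexive 3≤m _ (refl , inj₂ x↦x) = <⇒≱ 3≤m (mutual-successors x↦x x↦x)

  two-neighbours : 3 ≤ m → ∀ v → ∃₂ λ y z → v ~ y × v ~ z × y ≢ z
  two-neighbours 3≤m (c , x) with successor x | predecessor x
  ... | y , x↦y | z , z↦x =
    (c , y) , (c , z) , (refl , inj₁ x↦y) , (refl , inj₂ z↦x) ,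
    λ e → <⇒≱ 3≤m (mutual-successors x↦y (subst (λ w → CycSucc m w x) (sym (cong proj₂ e)) z↦x))

  at-most-two-neighbours : ∀ {v a b c} → v ~ a → v ~ b → v ~ c → a ≢ b → a ≢ c → b ≢ c → ⊥
  at-most-two-neighbours (refl , inj₁ p) (refl , inj₁ q) _ a≢b _ _ = a≢b (same-cycle (successor-unique p q))
  at-most-two-neighbours (refl , inj₁ p) (refl , inj₂ _) (refl , inj₁ r) _ a≢c _ = a≢c (same-cycle (successor-unique p r))
  at-most-two-neighbours (refl , inj₁ _) (refl , inj₂ q) (refl , inj₂ r) _ _ b≢c = b≢c (same-cycle (predecessor-unique q r))
  at-most-two-neighbours (refl , inj₂ p) (refl , inj₂ q) _ a≢b _ _ = a≢b (same-cycle (predecessor-unique p q))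
  at-most-two-neighbours (refl , inj₂ p) (refl , inj₁ _) (refl , inj₂ r) _ a≢c _ = a≢c (same-cycle (predecessor-unique p r))
  at-most-two-neighbours (refl , inj₂ _) (refl , inj₁ q) (refl , inj₁ r) _ _ b≢c = b≢c (same-cycle (successor-unique q r))

  triangle-free : 4 ≤ m → ∀ {a b c} → a ~ b → a ~ c → b ~ c → a ≢ b → a ≢ c → b ≢ c → ⊥
  triangle-free _   (refl , inj₁ p) (refl , inj₁ q) _ _ _ b≢c = b≢c (same-cycle (successor-unique p q))
  triangle-free _   (refl , inj₂ p) (refl , inj₂ q) _ _ _ b≢c = b≢c (same-cycle (predecessor-unique p q))
  triangle-free 4≤m (refl , inj₁ p) (refl , inj₂ q) (refl , inj₁ r) _ _ _ = <⇒≱ 4≤m (successor-triangle p r q)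
  triangle-free _   (refl , inj₁ _) (refl , inj₂ q) (refl , inj₂ r) a≢b _ _ = a≢b (same-cycle (successor-unique q r))
  triangle-free _   (refl , inj₂ p) (refl , inj₁ _) (refl , inj₁ r) _ a≢c _ = a≢c (same-cycle (successor-unique p r))
  triangle-free 4≤m (refl , inj₂ p) (refl , inj₁ q) (refl , inj₂ r) _ _ _ = <⇒≱ 4≤m (successor-triangle q r p)

-- An injection Fin a → Fin b with b ≤ a is onto: a missed point would let it
-- factor through Fin (b − 1), contradicting the pigeonhole principle.
injection-onto : ∀ {a b} (f : Fin a → Fin b) → b ≤ a →
                 (∀ x y → f x ≡ f y → x ≡ y) → ∀ y → ∃ λ x → f x ≡ y
injection-onto {b = suc b} f b<a f-injective y with any? {P = λ x → f x ≡ y} (λ x → f x ≟F y)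
... | yes hit = hit
... | no miss = collision (pigeonhole b<a (λ x → punchOut (missed x)))
  where
  missed : ∀ x → y ≢ f x
  missed x e = miss (x , sym e)
  collision : (∃₂ λ x x′ → toℕ x < toℕ x′ × punchOut (missed x) ≡ punchOut (missed x′)) → ∃ λ x → f x ≡ y
  collision (x , x′ , x<x′ , same) =
    ⊥-elim (<-irrefl (cong toℕ (f-injective x x′ (punchOut-injective (missed x) (missed x′) same))) x<x′)

encode : ∀ {m} → (Fin 2 × Fin m) ⊎ Fin 2 → Fin (2 * m + 2)
encode {m} (inj₁ (c , x)) = join (2 * m) 2 (inj₁ (combine c x))
encode {m} (inj₂ e)       = join (2 * m) 2 (inj₂ e)

encode-injective : ∀ {m} (u v : (Fin 2 × Fin m) ⊎ Fin 2) → encode u ≡ encode v → u ≡ v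
encode-injective {m} u v e = trans (sym (decode-encode u)) (trans (cong decode e) (decode-encode v))
  where
  decode : Fin (2 * m + 2) → (Fin 2 × Fin m) ⊎ Fin 2
  decode x = [ (λ y → inj₁ (remQuot m y)) , inj₂ ]′ (splitAt (2 * m) x)
  decode-encode : ∀ w → decode (encode w) ≡ w
  decode-encode (inj₁ (c , x)) rewrite splitAt-join (2 * m) 2 (inj₁ (combine c x)) = cong inj₁ (remQuot-combine c x)
  decode-encode (inj₂ e) rewrite splitAt-join (2 * m) 2 (inj₂ e) = refl

-- The consequences of a signature.  The vertex of an index k is the image of
-- k·s; only injectivity of π on integers is used, together with counting.
module Signature {n s i j m : ℕ} (n≡2+2m : n ≡ 2 + (m + m)) (4≤m : 4 ≤ m)
  (0<s : 0 < s) (0<i : 0 < i) (i<j : i < j)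
  (sig : HasSignature (Fin 2 × Fin m) (λ u v → u ≢ v × ¬ TwoCyclesAdj m u v) (SigSet n s i j)) where

  open TwoCycles m
  open ≡-Reasoning

  S : ℤ → Set
  S = SigSet n s i j

  π : Σ ℤ S → V
  π = proj₁ sig

  index? : ∀ k → Dec (Index n i j k)
  index? k = (1 ≤? k) ×-dec (k ≤? n) ×-dec ¬? (k ≟ i) ×-dec ¬? (k ≟ j)

  element : ∀ k → Index n i j k → Σ ℤ S
  element k (1≤k , k≤n , k≢i , k≢j) = + (k * s) , k , 1≤k , k≤n , k≢i , k≢j , refl

  -- The membership proof is irrelevant, so vertex k does not depend on it.
  vertex : ∀ k → .(Index n i j k) → V
  vertex k k∈ = π (element k (recompute (index? k) k∈))

  vertex-cong : ∀ {k l} .{p : Index n i j k} .{q : Index n i j l} → k ≡ l → vertex k p ≡ vertex l q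
  vertex-cong refl = refl

  scaled-injective : ∀ {k l} → + (k * s) ≡ + (l * s) → k ≡ l
  scaled-injective {k} {l} e = *-cancelʳ-≡ k l s {{>-nonZero 0<s}} (+-injective e)

  vertex-injective : ∀ {k l} .{p : Index n i j k} .{q : Index n i j l} → vertex k p ≡ vertex l q → k ≡ l
  vertex-injective e = scaled-injective (proj₁ (proj₂ sig) _ _ e)

  vertex-distinct : ∀ {k l} .{p : Index n i j k} .{q : Index n i j l} → k ≢ l → vertex k p ≢ vertex l q
  vertex-distinct k≢l e = k≢l (vertex-injective e)

  member-index : ∀ {d} → S (+ (d * s)) → Index n i j d
  member-index {d} (k , 1≤k , k≤n , k≢i , k≢j , e) with scaled-injective {d} {k} e
  ... | refl = 1≤k , k≤n , k≢i , k≢j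

  scaled-distance : ∀ k l → ℤ.∣ + (k * s) ℤ.- + (l * s) ∣ ≡ ∣ k - l ∣ * s
  scaled-distance k l = begin
    ℤ.∣ + (k * s) ℤ.- + (l * s) ∣  ≡⟨ cong ℤ.∣_∣ ([+m]-[+n]≡m⊖n (k * s) (l * s)) ⟩
    ℤ.∣ k * s ⊖ l * s ∣            ≡⟨ ∣⊖∣≡∣-∣ (k * s) (l * s) ⟩
    ∣ k * s - l * s ∣              ≡⟨ *-distribʳ-∣-∣ s k l ⟨
    ∣ k - l ∣ * s                  ∎

  G-adjacency : ∀ {k l} (p : Index n i j k) (q : Index n i j l) → k ≢ l →
                (vertex k p ≢ vertex l q × ¬ vertex k p ~ vertex l q) ⇔ Index n i j ∣ k - l ∣
  G-adjacency {k} {l} p q k≢l = mk⇔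
    (λ adj → member-index (subst S (cong +_ (scaled-distance k l)) (Equivalence.to criterion adj)))
    (λ d∈ → Equivalence.from criterion (subst S (cong +_ (sym (scaled-distance k l))) (proj₂ (element _ d∈))))
    where
    criterion : (vertex k p ≢ vertex l q × ¬ vertex k p ~ vertex l q) ⇔ S (+ ℤ.∣ + (k * s) ℤ.- + (l * s) ∣)
    criterion = proj₂ (proj₂ (proj₂ sig)) (element k (recompute (index? k) p)) (element l (recompute (index? l) q))
                  (λ e → k≢l (scaled-injective e))

  -- Nearness and adjacency are decidable, so both directions below can argue by contradiction.
  near? : ∀ k l → Dec (Near i j k l)
  near? k l = (∣ k - l ∣ ≟ i) ⊎-dec (∣ k - l ∣ ≟ j)

  near⇒distinct : ∀ {k l} → Near i j k l → k ≢ l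
  near⇒distinct {k} (inj₁ d≡i) refl = <⇒≢ 0<i (trans (sym (m≡n⇒∣m-n∣≡0 {k} refl)) d≡i)
  near⇒distinct {k} (inj₂ d≡j) refl = <⇒≢ (<-trans 0<i i<j) (trans (sym (m≡n⇒∣m-n∣≡0 {k} refl)) d≡j)

  far⇒distance-index : ∀ {k l} → Index n i j k → Index n i j l → k ≢ l → ¬ Near i j k l → Index n i j ∣ k - l ∣
  far⇒distance-index (_ , k≤n , _ , _) (_ , l≤n , _ , _) k≢l far =
    distance-positive k≢l , distance-bounded k≤n l≤n , (λ e → far (inj₁ e)) , (λ e → far (inj₂ e))

  distance-index⇒far : ∀ {k l} → Index n i j ∣ k - l ∣ → ¬ Near i j k l
  distance-index⇒far (_ , _ , d≢i , d≢j) = [ d≢i , d≢j ]′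

  adjacent⇔near : ∀ {k l} (p : Index n i j k) (q : Index n i j l) → k ≢ l →
                  vertex k p ~ vertex l q ⇔ Near i j k l
  adjacent⇔near {k} {l} p q k≢l = mk⇔
    (λ adj → decidable-stable (near? k l) λ far →
       proj₂ (Equivalence.from (G-adjacency p q k≢l) (far⇒distance-index p q k≢l far)) adj)
    (λ near → decidable-stable (adjacent? _ _) λ ¬adj →
       distance-index⇒far {k} {l}
         (Equivalence.to (G-adjacency p q k≢l) (vertex-distinct {p = p} {q = q} k≢l , ¬adj)) near)

  -- Counting.  Position k ∈ {1, …, n} goes to the vertex of k if k is an
  -- index, and to one of two spare points if k = i or k = j.
  slot : ∀ k → Dec (Index n i j k) → Dec (k ≡ i) → V ⊎ Fin 2
  slot k (yes k∈) _       = inj₁ (vertex k k∈)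
  slot k (no _)   (yes _) = inj₂ 0F
  slot k (no _)   (no _)  = inj₂ (sucF 0F)

  excluded-is-j : ∀ {k} → ¬ Index n i j k → 1 ≤ k → k ≤ n → k ≢ i → k ≡ j
  excluded-is-j {k} k∉ 1≤k k≤n k≢i = decidable-stable (k ≟ j) (λ k≢j → k∉ (1≤k , k≤n , k≢i , k≢j))

  slot-injective : ∀ {k l} dk ek dl el → 1 ≤ k → k ≤ n → 1 ≤ l → l ≤ n →
                   slot k dk ek ≡ slot l dl el → k ≡ l
  slot-injective (yes _) _ (yes _) _ _ _ _ _ e = vertex-injective (inj₁-injective e)
  slot-injective (no _) (yes k≡i) (no _) (yes l≡i) _ _ _ _ _ = trans k≡i (sym l≡i)
  slot-injective (no k∉) (no k≢i) (no l∉) (no l≢i) 1≤k k≤n 1≤l l≤n _ =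
    trans (excluded-is-j k∉ 1≤k k≤n k≢i) (sym (excluded-is-j l∉ 1≤l l≤n l≢i))
  slot-injective (yes _) _ (no _) (yes _) _ _ _ _ ()
  slot-injective (yes _) _ (no _) (no _)  _ _ _ _ ()
  slot-injective (no _) (yes _) (yes _) _ _ _ _ _ ()
  slot-injective (no _) (no _)  (yes _) _ _ _ _ _ ()
  slot-injective (no _) (yes _) (no _) (no _)  _ _ _ _ ()
  slot-injective (no _) (no _)  (no _) (yes _) _ _ _ _ ()

  slot-vertex : ∀ {k v} d e → slot k d e ≡ inj₁ v → Σ (Index n i j k) λ k∈ → vertex k k∈ ≡ v
  slot-vertex (yes k∈) _ refl = k∈ , refl
  slot-vertex (no _) (yes _) ()
  slot-vertex (no _) (no _)  ()

  position : Fin n → V ⊎ Fin 2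
  position x = slot (suc (toℕ x)) (index? _) (_ ≟ i)

  position-injective : ∀ x y → position x ≡ position y → x ≡ y
  position-injective x y e = toℕ-injective (suc-injective
    (slot-injective (index? _) (_ ≟ i) (index? _) (_ ≟ i) (s≤s z≤n) (toℕ<n x) (s≤s z≤n) (toℕ<n y) e))

  size : 2 * m + 2 ≤ n
  size = ≤-reflexive (trans 2m+2≡2+2m (sym n≡2+2m))
    where
    2m+2≡2+2m : 2 * m + 2 ≡ 2 + (m + m)
    2m+2≡2+2m = solve (m ∷ [])

  -- The n positions fill the n = 2m + 2 points of V ⊎ Fin 2, so every vertex
  -- is the vertex of an index.
  vertex-onto : ∀ v → ∃₂ λ k (k∈ : Index n i j k) → vertex k k∈ ≡ v
  vertex-onto v with injection-onto (λ x → encode (position x)) size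
                       (λ x y e → position-injective x y (encode-injective _ _ e)) (encode (inj₁ v))
  ... | x , e = suc (toℕ x) , slot-vertex (index? (suc (toℕ x))) (suc (toℕ x) ≟ i) (encode-injective _ _ e)

  3≤m : 3 ≤ m
  3≤m = <⇒≤ 4≤m

  adjacent : ∀ {k l} (p : Index n i j k) (q : Index n i j l) → Near i j k l → vertex k p ~ vertex l q
  adjacent p q near = Equivalence.from (adjacent⇔near p q (near⇒distinct near)) near

  lonely-neighbour : ∀ {k c} (k∈ : Index n i j k) → (∀ l → Index n i j l → Near i j k l → l ≡ c) →
                     ∀ y → vertex k k∈ ~ y → Σ (Index n i j c) λ c∈ → y ≡ vertex c c∈
  lonely-neighbour {k} {c} k∈ only y k~y = neighbour (vertex-onto y)
    where
    neighbour : (∃₂ λ l (l∈ : Index n i j l) → vertex l l∈ ≡ y) → Σ (Index n i j c) λ c∈ → y ≡ vertex c c∈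
    neighbour (l , l∈ , l↦y) = subst (Index n i j) l≡c l∈ , trans (sym l↦y) (vertex-cong l≡c)
      where
      k~l : vertex k k∈ ~ vertex l l∈
      k~l = subst (vertex k k∈ ~_) (sym l↦y) k~y
      k≢l : k ≢ l
      k≢l k≡l = irreflexive 3≤m (vertex k k∈) (subst (vertex k k∈ ~_) (sym (vertex-cong k≡l)) k~l)
      l≡c : l ≡ c
      l≡c = only l l∈ (Equivalence.to (adjacent⇔near k∈ l∈ k≢l) k~l)

  -- So the two distinct cycle-neighbours of a lonely index's vertex coincide.
  no-lonely : Lonely n i j → ⊥
  no-lonely (lonely k c k∈ only) = coincide (two-neighbours 3≤m (vertex k k∈))
    where
    coincide : (∃₂ λ y z → vertex k k∈ ~ y × vertex k k∈ ~ z × y ≢ z) → ⊥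
    coincide (y , z , k~y , k~z , y≢z) =
      y≢z (trans (proj₂ (lonely-neighbour k∈ only y k~y)) (sym (proj₂ (lonely-neighbour k∈ only z k~z))))

  -- A claw would give a vertex three distinct cycle-neighbours.
  no-claw : Claw n i j → ⊥
  no-claw (claw k a b c k∈ a∈ b∈ c∈ a≢b a≢c b≢c near-a near-b near-c) =
    at-most-two-neighbours (adjacent k∈ a∈ near-a) (adjacent k∈ b∈ near-b) (adjacent k∈ c∈ near-c)
      (vertex-distinct {p = a∈} {q = b∈} a≢b) (vertex-distinct {p = a∈} {q = c∈} a≢c)
      (vertex-distinct {p = b∈} {q = c∈} b≢c)

  -- A triangle would give a triangle in the two cycles.
  no-triangle : Triangle n i j → ⊥
  no-triangle (triangle a b c a∈ b∈ c∈ a≢b a≢c b≢c near-ab near-ac near-bc) =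
    triangle-free 4≤m (adjacent a∈ b∈ near-ab) (adjacent a∈ c∈ near-ac) (adjacent b∈ c∈ near-bc)
      (vertex-distinct {p = a∈} {q = b∈} a≢b) (vertex-distinct {p = a∈} {q = c∈} a≢c)
      (vertex-distinct {p = b∈} {q = c∈} b≢c)

  no-obstruction : Obstruction n i j → ⊥
  no-obstruction = [ no-lonely , [ no-claw , no-triangle ]′ ]′

even-split : ∀ n → 2 ≤ n → 2 ∣ n → n ≡ 2 + ((n ∸ 2) / 2 + (n ∸ 2) / 2)
even-split .(suc q * 2) _ (divides (suc q) refl) =
  trans double (cong (λ h → 2 + (h + h)) (sym (m*n/n≡m q 2)))
  where
  double : suc q * 2 ≡ 2 + (q + q)
  double = solve (q ∷ [])

cycle-length : ∀ m → 10 ≤ 2 + (m + m) → 4 ≤ m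
cycle-length m 10≤n = ≰⇒> λ m≤3 → <⇒≱ (≤-by 1 refl) (≤-trans 10≤n (s≤s (s≤s (+-mono-≤ m≤3 m≤3))))

lemma9 : (n s i j : ℕ) → 10 ≤ n → 2 ∣ n → 0 < s → 1 ≤ i → i < j → j ≤ n →
         ¬ HasSignature (GVertex n) (GAdj n) (SigSet n s i j)
lemma9 n s i j 10≤n 2∣n 0<s 1≤i i<j j≤n sig =
  Signature.no-obstruction n≡2+2m (cycle-length _ (subst (10 ≤_) n≡2+2m 10≤n)) 0<s 1≤i i<j sig
    (obstruction n i j 10≤n 1≤i i<j j≤n)
  where
  n≡2+2m : n ≡ 2 + ((n ∸ 2) / 2 + (n ∸ 2) / 2)
  n≡2+2m = even-split n (≤-trans (≤-by 8 refl) 10≤n) 2∣n
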